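{- Let $I$ be a weighted graph with two clusters $C_1,C_2\subseteq V(I)$ such that the $I$-effective resistance diameters of $C_1$ and $C_2$ are both at most $R$, and the minimum effective resistance between a vertex of $C_1$ and a vertex of $C_2$ is at least $\gamma R$, for some $\gamma>4$. Let $J$ be the graph obtained from $I$ by identifying $C_1$ to a vertex $s$ and $C_2$ to a vertex $t$. Then $\mathrm{Reff}_J(s,t)\ge(\gamma-4)R$.
   Context: Effective resistance $\mathrm{Reff}_K(u,v)=b_{uv}^TL_K^+b_{uv}$; the effective resistance diameter of a cluster $C$ in $K$ is $\max_{u,v\in C}\mathrm{Reff}_K(u,v)$. -}

module Defs where

open import Level using (Level; _⊔_) renaming (suc to lsuc)
open import Algebra.Bundles using (CommutativeRing)
open import Relation.Binary.Core using (Rel)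
open import Relation.Binary.Structures using (IsTotalOrder)
open import Relation.Nullary using (¬_)
open import Relation.Nullary.Decidable using (⌊_⌋)
open import Relation.Binary.PropositionalEquality using (_≡_)
open import Data.Bool using (if_then_else_; _∧_)
open import Data.Nat using (ℕ)
open import Data.Fin using (Fin; _≟_)
open import Data.Fin.Subset using (Subset; _∈_; _∉_)
open import Data.Product using (_×_; ∃)
open import Function.Definitions using (Surjective)

-- Ordered fields (the scalars; ℝ is the intended model).

record OrderedField (c ℓ₁ ℓ₂ : Level) : Set (lsuc (c ⊔ ℓ₁ ⊔ ℓ₂)) where
  field
    commutativeRing : CommutativeRing c ℓ₁
  open CommutativeRing commutativeRing public
  infix 4 _≤_ _<_
  field
    _≤_          : Rel Carrier ℓ₂
    isTotalOrder : IsTotalOrder _≈_ _≤_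
    +-monoˡ-≤    : ∀ {x y} z → x ≤ y → (x + z) ≤ (y + z)
    *-nonneg     : ∀ {x y} → 0# ≤ x → 0# ≤ y → 0# ≤ (x * y)
    0≉1          : ¬ (0# ≈ 1#)
    inverse      : ∀ x → ¬ (x ≈ 0#) → ∃ λ y → (x * y) ≈ 1#

  _<_ : Rel Carrier (ℓ₁ ⊔ ℓ₂)
  x < y = (x ≤ y) × ¬ (x ≈ y)

  4# : Carrier
  4# = 1# + 1# + 1# + 1#

module _ {c ℓ₁ ℓ₂} (F : OrderedField c ℓ₁ ℓ₂) where
  open OrderedField F
  open import Algebra.Definitions.RawMonoid +-rawMonoid using (sum)

  infixl 7 _⊗_
  infix 4 _≈ₘ_

  Matrix : ℕ → Set c
  Matrix n = Fin n → Fin n → Carrier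

  Σ : ∀ {n} → (Fin n → Carrier) → Carrier
  Σ = sum

  _⊗_ : ∀ {n} → Matrix n → Matrix n → Matrix n
  (A ⊗ B) i j = Σ (λ k → A i k * B k j)

  _ᵀ : ∀ {n} → Matrix n → Matrix n
  (A ᵀ) i j = A j i

  _≈ₘ_ : ∀ {n} → Matrix n → Matrix n → Set ℓ₁
  A ≈ₘ B = ∀ i j → A i j ≈ B i j

  IsPseudoinverse : ∀ {n} → Matrix n → Matrix n → Set ℓ₁
  IsPseudoinverse A X =
    ((A ⊗ X) ⊗ A ≈ₘ A) × ((X ⊗ A) ⊗ X ≈ₘ X) ×
    (((A ⊗ X) ᵀ) ≈ₘ (A ⊗ X)) × (((X ⊗ A) ᵀ) ≈ₘ (X ⊗ A))

  -- weighted graph on vertex set Fin n: symmetric nonnegative weights,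
  -- w i j > 0 means an edge of weight w i j (diagonal entries are ignored)
  Weights : ℕ → Set c
  Weights n = Fin n → Fin n → Carrier

  IsWeightedGraph : ∀ {n} → Weights n → Set (ℓ₁ ⊔ ℓ₂)
  IsWeightedGraph w = (∀ i j → w i j ≈ w j i) × (∀ i j → 0# ≤ w i j)

  data Reachable {n} (w : Weights n) (i : Fin n) : Fin n → Set (c ⊔ ℓ₁ ⊔ ℓ₂) where
    here : Reachable w i i
    step : ∀ {j k} → Reachable w i j → 0# < w j k → Reachable w i k

  Connected : ∀ {n} → Weights n → Set (c ⊔ ℓ₁ ⊔ ℓ₂)
  Connected w = ∀ i j → Reachable w i j

  -- graph Laplacian L = D - W (self-loops do not contribute)
  Laplacian : ∀ {n} → Weights n → Matrix n
  Laplacian w i j =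
    if ⌊ i ≟ j ⌋ then Σ (λ k → if ⌊ i ≟ k ⌋ then 0# else w i k) else - w i j

  χ : ∀ {n} → Fin n → Fin n → Carrier
  χ u i = if ⌊ u ≟ i ⌋ then 1# else 0#

  b : ∀ {n} → Fin n → Fin n → Fin n → Carrier
  b u v i = χ u i - χ v i

  quad : ∀ {n} → Matrix n → (Fin n → Carrier) → Carrier
  quad X x = Σ (λ i → Σ (λ j → x i * X i j * x j))

  -- Reff(u,v) = b_uvᵀ L⁺ b_uv, where X = L⁺
  Reff : ∀ {n} → Matrix n → Fin n → Fin n → Carrier
  Reff X u v = quad X (b u v)

  -- weighted graph obtained by identifying vertices along π : Fin n → Fin m
  -- (parallel edges are merged by adding weights; loops are ignored by the Laplacian)
  Contract : ∀ {n m} → Weights n → (Fin n → Fin m) → Weights m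
  Contract w π a a' =
    Σ (λ i → Σ (λ j → if ⌊ π i ≟ a ⌋ ∧ ⌊ π j ≟ a' ⌋ then w i j else 0#))

IsIdentification : ∀ {n m} → Subset n → Subset n → (Fin n → Fin m) → Fin m → Fin m → Set
IsIdentification C₁ C₂ π s t =
  Surjective _≡_ _≡_ π ×
  (∀ i → (i ∈ C₁ → π i ≡ s) × (π i ≡ s → i ∈ C₁)) ×
  (∀ i → (i ∈ C₂ → π i ≡ t) × (π i ≡ t → i ∈ C₂)) ×
  (∀ i j → i ∉ C₁ → i ∉ C₂ → π i ≡ π j → i ≡ j)

-- Take u ∈ C₁, v ∈ C₂ and the potential ψ = L⁺ b_uv, so that ψ u − ψ v = D = Reff(u,v)
-- and ψ has energy D. By reciprocity of potentials and the maximum principle, ψ stays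
-- within R of ψ u on C₁ and within R of ψ v on C₂. Clamping ψ to [ψ v + R, ψ u − R]
-- does not increase energy and makes it constant on each cluster, so it descends to a
-- function φ on J with φ s − φ t = D − 2R and energy at most D. Dirichlet's principle
-- in J, in the division-free form 2 (φ s − φ t) ≤ Reff_J(s,t) + energy(φ), then gives
-- D − 4R ≤ Reff_J(s,t), and D ≥ γ R by separation.

module Submission where

open import Defs
open import Algebra.Bundles using (CommutativeRing; RawRing)
open import Data.Nat using (ℕ; zero; suc) renaming (_+_ to _+ℕ_; _*_ to _*ℕ_)
import Data.Nat.Properties as ℕ
open import Data.Fin using (Fin; zero; suc; _≟_)
open import Data.Fin.Properties using (suc-injective)
open import Data.Fin.Subset using (Subset; _∈_; _∉_)
open import Data.Fin.Subset.Properties using (_∈?_)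
open import Data.List using (allFin)
import Data.List.Relation.Unary.All as All
open import Data.List.Membership.Propositional.Properties using (∈-allFin)
open import Data.Product using (_×_; _,_; proj₁; proj₂)
open import Data.Sum using (_⊎_; inj₁; inj₂; [_,_]′)
open import Data.Maybe using (Maybe; just; nothing)
open import Data.Bool using (if_then_else_; _∧_)
open import Data.Empty using (⊥-elim)
open import Function using (_∘_)
open import Function.Definitions using (Surjective)
open import Relation.Nullary using (¬_; yes; no)
open import Relation.Nullary.Decidable using (⌊_⌋)
open import Relation.Binary.Bundles using (TotalOrder)
open import Relation.Binary.Structures using (IsTotalOrder)
open import Relation.Binary.PropositionalEquality as ≡ using (_≡_; _≢_)
import Relation.Binary.Reasoning.PartialOrder

-- Coefficients are integers a − b given as pairs (a , b), kept in the form
-- (k , 0) or (0 , k): the solver closes goals by refl, so equal normal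
-- forms must evaluate to definitionally equal terms.
module IntegerCoefficientSolver {c ℓ} (CR : CommutativeRing c ℓ) where
  open CommutativeRing CR
  open import Algebra.Properties.Semiring.Mult semiring using (×1-homo-*) renaming (_×_ to _·_)
  open import Algebra.Properties.Monoid.Mult +-monoid using (×-homo-+)
  open import Algebra.Properties.Ring ring
    using (-‿+-comm; -‿distribˡ-*; -‿distribʳ-*; -‿involutive; -0#≈0#; ⁻¹-anti-homo‿-)
  open import Algebra.Solver.Ring.AlmostCommutativeRing using (fromCommutativeRing; _-Raw-AlmostCommutative⟶_)
  open import Relation.Binary.Reasoning.Setoid setoid
  open import Algebra.Properties.CommutativeSemigroup +-commutativeSemigroup using (interchange)

  Difference : Set
  Difference = ℕ × ℕ

  canonical : ℕ → ℕ → Difference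
  canonical (suc a) (suc b) = canonical a b
  canonical a b = a , b

  ⟦_⟧ : Difference → Carrier
  ⟦ a , b ⟧ = a · 1# - b · 1#

  private
    -‿distrib-+ : ∀ a b c d → (a + c) - (b + d) ≈ (a - b) + (c - d)
    -‿distrib-+ a b c d = trans (+-congˡ (sym (-‿+-comm b d))) (interchange a c (- b) (- d))

    -‿distrib-* : ∀ a b c d → (a * c + b * d) - (a * d + b * c) ≈ (a - b) * (c - d)
    -‿distrib-* a b c d = sym (begin
      (a - b) * (c - d)                          ≈⟨ distribʳ _ _ _ ⟩
      a * (c - d) + - b * (c - d)                ≈⟨ +-cong (distribˡ _ _ _) (distribˡ _ _ _) ⟩
      (a * c + a * - d) + (- b * c + - b * - d)  ≈⟨ +-cong (+-congˡ (sym (-‿distribʳ-* a d))) (+-cong (sym (-‿distribˡ-* b c)) neg*neg) ⟩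
      (a * c - a * d) + (- (b * c) + b * d)      ≈⟨ +-congˡ (+-comm _ _) ⟩
      (a * c - a * d) + (b * d - b * c)          ≈⟨ sym (-‿distrib-+ _ _ _ _) ⟩
      (a * c + b * d) - (a * d + b * c)          ∎)
      where
      neg*neg : - b * - d ≈ b * d
      neg*neg = trans (sym (-‿distribˡ-* b (- d))) (trans (-‿cong (sym (-‿distribʳ-* b d))) (-‿involutive _))

    ⟦suc⟧ : ∀ a b → ⟦ suc a , suc b ⟧ ≈ ⟦ a , b ⟧
    ⟦suc⟧ a b = begin
      (1# + a · 1#) - (1# + b · 1#)    ≈⟨ -‿distrib-+ _ _ _ _ ⟩
      (1# - 1#) + (a · 1# - b · 1#)    ≈⟨ +-congʳ (-‿inverseʳ 1#) ⟩
      0# + (a · 1# - b · 1#)           ≈⟨ +-identityˡ _ ⟩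
      a · 1# - b · 1#                  ∎

    ⟦+ℕ⟧ : ∀ k a b → ⟦ k +ℕ a , k +ℕ b ⟧ ≈ ⟦ a , b ⟧
    ⟦+ℕ⟧ zero    a b = refl
    ⟦+ℕ⟧ (suc k) a b = trans (⟦suc⟧ (k +ℕ a) (k +ℕ b)) (⟦+ℕ⟧ k a b)

    ⟦canonical⟧ : ∀ a b → ⟦ canonical a b ⟧ ≈ ⟦ a , b ⟧
    ⟦canonical⟧ zero    b       = refl
    ⟦canonical⟧ (suc a) zero    = refl
    ⟦canonical⟧ (suc a) (suc b) = trans (⟦canonical⟧ a b) (sym (⟦suc⟧ a b))

    -‿cong₂ : ∀ {a b c d} → a ≈ b → c ≈ d → a - c ≈ b - d
    -‿cong₂ p q = +-cong p (-‿cong q)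

  coefficients : RawRing _ _
  coefficients = record
    { Carrier = Difference ; _≈_ = _≡_
    ; _+_ = λ { (a , b) (c , d) → canonical (a +ℕ c) (b +ℕ d) }
    ; _*_ = λ { (a , b) (c , d) → canonical (a *ℕ c +ℕ b *ℕ d) (a *ℕ d +ℕ b *ℕ c) }
    ; -_ = λ { (a , b) → b , a }
    ; 0# = 0 , 0 ; 1# = 1 , 0 }

  ⟦⟧-homomorphism : coefficients -Raw-AlmostCommutative⟶ fromCommutativeRing CR
  ⟦⟧-homomorphism = record
    { ⟦_⟧ = ⟦_⟧
    ; +-homo = λ { (a , b) (c , d) → trans (⟦canonical⟧ (a +ℕ c) (b +ℕ d))
        (trans (-‿cong₂ (×-homo-+ 1# a c) (×-homo-+ 1# b d)) (-‿distrib-+ _ _ _ _)) }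
    ; *-homo = λ { (a , b) (c , d) → trans (⟦canonical⟧ (a *ℕ c +ℕ b *ℕ d) (a *ℕ d +ℕ b *ℕ c))
        (trans (-‿cong₂ (×·-homo a c b d) (×·-homo a d b c)) (-‿distrib-* _ _ _ _)) }
    ; -‿homo = λ { (a , b) → sym (⁻¹-anti-homo‿- (a · 1#) (b · 1#)) }
    ; 0-homo = -‿inverseʳ 0#
    ; 1-homo = trans (+-congˡ -0#≈0#) (trans (+-identityʳ _) (+-identityʳ 1#))
    }
    where
    ×·-homo : ∀ a c b d → (a *ℕ c +ℕ b *ℕ d) · 1# ≈ (a · 1#) * (c · 1#) + (b · 1#) * (d · 1#)
    ×·-homo a c b d = trans (×-homo-+ 1# (a *ℕ c) (b *ℕ d)) (+-cong (×1-homo-* a c) (×1-homo-* b d))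

  _≟⟦⟧_ : ∀ p q → Maybe (⟦ p ⟧ ≈ ⟦ q ⟧)
  (a , b) ≟⟦⟧ (c , d) with a +ℕ d ℕ.≟ b +ℕ c
  ... | no _  = nothing
  ... | yes e = just (begin
      ⟦ a , b ⟧                ≈⟨ sym (⟦+ℕ⟧ d a b) ⟩
      ⟦ d +ℕ a , d +ℕ b ⟧      ≡⟨ ≡.cong₂ (λ x y → ⟦ x , y ⟧) (≡.trans (ℕ.+-comm d a) e) (ℕ.+-comm d b) ⟩
      ⟦ b +ℕ c , b +ℕ d ⟧      ≈⟨ ⟦+ℕ⟧ b c d ⟩
      ⟦ c , d ⟧                ∎)

  open import Algebra.Solver.Ring coefficients (fromCommutativeRing CR) ⟦⟧-homomorphism _≟⟦⟧_ public
    using (solve; _:+_; _:*_; _:-_; :-_; _:=_)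


module OrderedFieldProperties {c ℓ₁ ℓ₂} (F : OrderedField c ℓ₁ ℓ₂) where
  open OrderedField F
  open IntegerCoefficientSolver commutativeRing
  open import Algebra.Properties.Ring ring using (-0#≈0#)
  open import Relation.Binary.Reasoning.Setoid setoid
  open IsTotalOrder isTotalOrder public
    using (total; antisym)
    renaming (refl to ≤-refl; trans to ≤-trans; reflexive to ≤-reflexive;
              ≤-respˡ-≈ to ≤-respˡ; ≤-respʳ-≈ to ≤-respʳ)

  ≤-totalOrder : TotalOrder c ℓ₁ ℓ₂
  ≤-totalOrder = record { isTotalOrder = isTotalOrder }

  module ≤-Reasoning = Relation.Binary.Reasoning.PartialOrder (TotalOrder.poset ≤-totalOrder)

  +-monoʳ-≤ : ∀ {x y} z → x ≤ y → z + x ≤ z + y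
  +-monoʳ-≤ {x} {y} z x≤y = ≤-respˡ (+-comm x z) (≤-respʳ (+-comm y z) (+-monoˡ-≤ z x≤y))

  +-mono-≤ : ∀ {x y u v} → x ≤ y → u ≤ v → x + u ≤ y + v
  +-mono-≤ {y = y} {u} x≤y u≤v = ≤-trans (+-monoˡ-≤ u x≤y) (+-monoʳ-≤ y u≤v)

  x≤y⇒0≤y-x : ∀ {x y} → x ≤ y → 0# ≤ y - x
  x≤y⇒0≤y-x {x} x≤y = ≤-respˡ (-‿inverseʳ x) (+-monoˡ-≤ (- x) x≤y)

  0≤y-x⇒x≤y : ∀ {x y} → 0# ≤ y - x → x ≤ y
  0≤y-x⇒x≤y {x} {y} 0≤y-x = ≤-respˡ (+-identityˡ x)
    (≤-respʳ (solve 2 (λ y x → (y :- x) :+ x := y) refl y x) (+-monoˡ-≤ x 0≤y-x))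

  0≤d≈y-x⇒x≤y : ∀ {d x y} → d ≈ y - x → 0# ≤ d → x ≤ y
  0≤d≈y-x⇒x≤y d≈y-x 0≤d = 0≤y-x⇒x≤y (≤-respʳ d≈y-x 0≤d)

  +-cancelʳ-≤ : ∀ {x y} z → x + z ≤ y + z → x ≤ y
  +-cancelʳ-≤ {x} {y} z x+z≤y+z = 0≤d≈y-x⇒x≤y (solve 3 (λ x y z → (y :+ z) :- (x :+ z) := y :- x) refl x y z)
    (x≤y⇒0≤y-x x+z≤y+z)

  -‿antimono-≤ : ∀ {x y} → x ≤ y → - y ≤ - x
  -‿antimono-≤ {x} {y} x≤y =
    0≤d≈y-x⇒x≤y (solve 2 (λ x y → y :- x := :- x :- :- y) refl x y) (x≤y⇒0≤y-x x≤y)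

  x*x-nonneg : ∀ x → 0# ≤ x * x
  x*x-nonneg x with total 0# x
  ... | inj₁ 0≤x = *-nonneg 0≤x 0≤x
  ... | inj₂ x≤0 = ≤-respʳ (solve 1 (λ x → :- x :* :- x := x :* x) refl x) (*-nonneg 0≤-x 0≤-x)
    where
    0≤-x : 0# ≤ - x
    0≤-x = ≤-respˡ -0#≈0# (-‿antimono-≤ x≤0)

  0≤1 : 0# ≤ 1#
  0≤1 = ≤-respʳ (*-identityˡ 1#) (x*x-nonneg 1#)

  *-monoˡ-≤-nonneg : ∀ {x y} z → 0# ≤ z → x ≤ y → z * x ≤ z * y
  *-monoˡ-≤-nonneg {x} {y} z 0≤z x≤y = 0≤d≈y-x⇒x≤y
    (solve 3 (λ z x y → z :* (y :- x) := z :* y :- z :* x) refl z x y)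
    (*-nonneg 0≤z (x≤y⇒0≤y-x x≤y))

  x*x-mono-nonneg : ∀ {x y} → 0# ≤ x → x ≤ y → x * x ≤ y * y
  x*x-mono-nonneg {x} {y} 0≤x x≤y = ≤-trans (*-monoˡ-≤-nonneg x 0≤x x≤y)
    (≤-respˡ (*-comm y x) (*-monoˡ-≤-nonneg y (≤-trans 0≤x x≤y) x≤y))

  +-nonneg : ∀ {x y} → 0# ≤ x → 0# ≤ y → 0# ≤ x + y
  +-nonneg 0≤x 0≤y = ≤-respˡ (+-identityʳ 0#) (+-mono-≤ 0≤x 0≤y)

  x+x≤y+y⇒x≤y : ∀ {x y} → x + x ≤ y + y → x ≤ y
  x+x≤y+y⇒x≤y {x} {y} x+x≤y+y with total x y
  ... | inj₁ x≤y = x≤y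
  ... | inj₂ y≤x = 0≤d≈y-x⇒x≤y
    (solve 2 (λ x y → ((y :+ y) :- (x :+ x)) :+ (x :- y) := y :- x) refl x y)
    (+-nonneg (x≤y⇒0≤y-x x+x≤y+y) (x≤y⇒0≤y-x y≤x))

  x*y≈0⇒y≈0 : ∀ {x y} → ¬ (x ≈ 0#) → x * y ≈ 0# → y ≈ 0#
  x*y≈0⇒y≈0 {x} {y} x≉0 xy≈0 with inverse x x≉0
  ... | x⁻¹ , xx⁻¹≈1 = begin
    y                ≈⟨ *-identityˡ y ⟨
    1# * y           ≈⟨ *-congʳ xx⁻¹≈1 ⟨
    (x * x⁻¹) * y    ≈⟨ solve 3 (λ x x⁻¹ y → (x :* x⁻¹) :* y := x⁻¹ :* (x :* y)) refl x x⁻¹ y ⟩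
    x⁻¹ * (x * y)    ≈⟨ *-congˡ xy≈0 ⟩
    x⁻¹ * 0#         ≈⟨ zeroʳ x⁻¹ ⟩
    0#               ∎

  0≤x⇒y-y≤x : ∀ {x} y → 0# ≤ x → y - y ≤ x
  0≤x⇒y-y≤x y 0≤x = ≤-respˡ (sym (-‿inverseʳ y)) 0≤x

  open import Algebra.Construct.NaturalChoice.Min ≤-totalOrder public
    using (_⊓_; x⊓y≤y; x≤y⇒x⊓y≈x; x≤y⇒y⊓x≈x; ⊓-monoʳ-≤)
  open import Algebra.Construct.NaturalChoice.Max ≤-totalOrder public
    using (_⊔_; ⊔-congˡ; x≤y⊔x; x≤y⇒x⊔y≈y; x≤y⇒y⊔x≈y; ⊔-monoʳ-≤)

  ⊓-nonexpanding : ∀ h {x y} → x ≤ y → (h ⊓ y) - (h ⊓ x) ≤ y - x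
  ⊓-nonexpanding h {x} {y} x≤y = [ h≤x-case , x≤h-case ]′ (total h x)
    where
    h≤x-case : h ≤ x → (h ⊓ y) - (h ⊓ x) ≤ y - x
    h≤x-case h≤x = ≤-respˡ (+-cong (sym (x≤y⇒x⊓y≈x (≤-trans h≤x x≤y))) (-‿cong (sym (x≤y⇒x⊓y≈x h≤x))))
                     (0≤x⇒y-y≤x h (x≤y⇒0≤y-x x≤y))
    x≤h-case : x ≤ h → (h ⊓ y) - (h ⊓ x) ≤ y - x
    x≤h-case x≤h = ≤-respˡ (+-congˡ (-‿cong (sym (x≤y⇒y⊓x≈x x≤h)))) (+-monoˡ-≤ (- x) (x⊓y≤y h y))

  ⊔-nonexpanding : ∀ l {x y} → x ≤ y → (l ⊔ y) - (l ⊔ x) ≤ y - x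
  ⊔-nonexpanding l {x} {y} x≤y = [ l≤y-case , y≤l-case ]′ (total l y)
    where
    l≤y-case : l ≤ y → (l ⊔ y) - (l ⊔ x) ≤ y - x
    l≤y-case l≤y = ≤-respˡ (+-congʳ (sym (x≤y⇒x⊔y≈y l≤y))) (+-monoʳ-≤ y (-‿antimono-≤ (x≤y⊔x l x)))
    y≤l-case : y ≤ l → (l ⊔ y) - (l ⊔ x) ≤ y - x
    y≤l-case y≤l = ≤-respˡ (+-cong (sym (x≤y⇒y⊔x≈y y≤l)) (-‿cong (sym (x≤y⇒y⊔x≈y (≤-trans x≤y y≤l)))))
                     (0≤x⇒y-y≤x l (x≤y⇒0≤y-x x≤y))

  x-y≤z⇒x-z≤y : ∀ {x y z} → x - y ≤ z → x - z ≤ y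
  x-y≤z⇒x-z≤y {x} {y} {z} x-y≤z =
    0≤d≈y-x⇒x≤y (solve 3 (λ x y z → z :- (x :- y) := y :- (x :- z)) refl x y z) (x≤y⇒0≤y-x x-y≤z)

  x-y≤z⇒x≤y+z : ∀ {x y z} → x - y ≤ z → x ≤ y + z
  x-y≤z⇒x≤y+z {x} {y} {z} x-y≤z =
    0≤d≈y-x⇒x≤y (solve 3 (λ x y z → z :- (x :- y) := (y :+ z) :- x) refl x y z) (x≤y⇒0≤y-x x-y≤z)

  4#*x≈x+x+x+x : ∀ x → 4# * x ≈ x + x + x + x
  4#*x≈x+x+x+x x = trans (solve 2 (λ o x → (o :+ o :+ o :+ o) :* x := o :* x :+ o :* x :+ o :* x :+ o :* x) refl 1# x)
    (+-cong (+-cong (+-cong (*-identityˡ x) (*-identityˡ x)) (*-identityˡ x)) (*-identityˡ x))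

  [x-y]²≈[y-x]² : ∀ x y → (x - y) * (x - y) ≈ (y - x) * (y - x)
  [x-y]²≈[y-x]² = solve 2 (λ x y → (x :- y) :* (x :- y) := (y :- x) :* (y :- x)) refl

  clamp : Carrier → Carrier → Carrier → Carrier
  clamp l h x = l ⊔ (h ⊓ x)

  module _ (l h : Carrier) where

    clamp-monotone : ∀ {x y} → x ≤ y → clamp l h x ≤ clamp l h y
    clamp-monotone x≤y = ⊔-monoʳ-≤ l (⊓-monoʳ-≤ h x≤y)

    clamp-nonexpanding : ∀ {x y} → x ≤ y → clamp l h y - clamp l h x ≤ y - x
    clamp-nonexpanding x≤y = ≤-trans (⊔-nonexpanding l (⊓-monoʳ-≤ h x≤y)) (⊓-nonexpanding h x≤y)

    private
      clamp-contracts-squares-≤ : ∀ {x y} → x ≤ y →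
        (clamp l h y - clamp l h x) * (clamp l h y - clamp l h x) ≤ (y - x) * (y - x)
      clamp-contracts-squares-≤ x≤y =
        x*x-mono-nonneg (x≤y⇒0≤y-x (clamp-monotone x≤y)) (clamp-nonexpanding x≤y)

    clamp-contracts-squares : ∀ x y →
      (clamp l h x - clamp l h y) * (clamp l h x - clamp l h y) ≤ (x - y) * (x - y)
    clamp-contracts-squares x y with total x y
    ... | inj₁ x≤y = ≤-respˡ ([x-y]²≈[y-x]² _ _) (≤-respʳ ([x-y]²≈[y-x]² y x) (clamp-contracts-squares-≤ x≤y))
    ... | inj₂ y≤x = clamp-contracts-squares-≤ y≤x

    clamp≈upper : ∀ {x} → l ≤ h → h ≤ x → clamp l h x ≈ h
    clamp≈upper l≤h h≤x = trans (⊔-congˡ l (x≤y⇒x⊓y≈x h≤x)) (x≤y⇒x⊔y≈y l≤h)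

    clamp≈lower : ∀ {x} → x ≤ l → clamp l h x ≈ l
    clamp≈lower {x} x≤l = x≤y⇒y⊔x≈y (≤-trans (x⊓y≤y h x) x≤l)

module Summation {c ℓ₁ ℓ₂} (F : OrderedField c ℓ₁ ℓ₂) where
  open OrderedField F hiding (zero)
  open OrderedFieldProperties F
  open IntegerCoefficientSolver commutativeRing
  open import Algebra.Properties.Ring ring using (-0#≈0#; -‿+-comm)
  import Algebra.Properties.Semiring.Sum semiring as Sum

  -- An opaque copy of sum: unlike sum, which computes by recursion on n,
  -- ∑ is rigid, so Agda can infer the summand from a goal ∑ f ≈ ….
  opaque
    ∑ : ∀ {n} → (Fin n → Carrier) → Carrier
    ∑ = Sum.sum

    Σ≈∑ : ∀ {n} (f : Fin n → Carrier) → Σ F f ≈ ∑ f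
    Σ≈∑ f = refl

    ∑-cong : ∀ {n} {f g : Fin n → Carrier} → (∀ i → f i ≈ g i) → ∑ f ≈ ∑ g
    ∑-cong = Sum.sum-cong-≋

    ∑-zero : ∀ {n} {f : Fin n → Carrier} → (∀ i → f i ≈ 0#) → ∑ f ≈ 0#
    ∑-zero {n} f≈0 = trans (Sum.sum-cong-≋ f≈0) (Sum.sum-replicate-zero n)

    ∑-distrib-+ : ∀ {n} (f g : Fin n → Carrier) → ∑ (λ i → f i + g i) ≈ ∑ f + ∑ g
    ∑-distrib-+ = Sum.∑-distrib-+

    ∑-comm : ∀ {m n} (f : Fin m → Fin n → Carrier) → ∑ (λ i → ∑ (λ j → f i j)) ≈ ∑ (λ j → ∑ (λ i → f i j))
    ∑-comm = Sum.∑-comm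

    *-distribˡ-∑ : ∀ {n} x (f : Fin n → Carrier) → x * ∑ f ≈ ∑ (λ i → x * f i)
    *-distribˡ-∑ = Sum.*-distribˡ-sum

    *-distribʳ-∑ : ∀ {n} x (f : Fin n → Carrier) → ∑ f * x ≈ ∑ (λ i → f i * x)
    *-distribʳ-∑ = Sum.*-distribʳ-sum

    ∑-neg : ∀ {n} (f : Fin n → Carrier) → ∑ (λ i → - f i) ≈ - ∑ f
    ∑-neg {zero}  f = sym -0#≈0#
    ∑-neg {suc n} f = trans (+-congˡ (∑-neg (f ∘ suc))) (-‿+-comm _ _)

    ∑-concentrated : ∀ {n} k (f : Fin n → Carrier) → (∀ i → k ≢ i → f i ≈ 0#) → ∑ f ≈ f k
    ∑-concentrated zero    f f≈0 = trans (+-congˡ (∑-zero (λ i → f≈0 (suc i) λ ()))) (+-identityʳ _)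
    ∑-concentrated (suc k) f f≈0 = trans
      (+-cong (f≈0 zero λ ()) (∑-concentrated k (f ∘ suc) λ i k≢i → f≈0 (suc i) (k≢i ∘ suc-injective)))
      (+-identityˡ _)

    ∑-mono-≤ : ∀ {n} {f g : Fin n → Carrier} → (∀ i → f i ≤ g i) → ∑ f ≤ ∑ g
    ∑-mono-≤ {zero}  f≤g = ≤-refl
    ∑-mono-≤ {suc n} f≤g = +-mono-≤ (f≤g zero) (∑-mono-≤ (f≤g ∘ suc))

    ∑-nonneg : ∀ {n} {f : Fin n → Carrier} → (∀ i → 0# ≤ f i) → 0# ≤ ∑ f
    ∑-nonneg {zero}  0≤f = ≤-refl
    ∑-nonneg {suc n} 0≤f = +-nonneg (0≤f zero) (∑-nonneg (0≤f ∘ suc))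

    term≤∑ : ∀ {n} {f : Fin n → Carrier} → (∀ i → 0# ≤ f i) → ∀ k → f k ≤ ∑ f
    term≤∑ {f = f} 0≤f zero    = ≤-respˡ (+-identityʳ (f zero)) (+-monoʳ-≤ (f zero) (∑-nonneg (0≤f ∘ suc)))
    term≤∑ {f = f} 0≤f (suc k) = ≤-respˡ (+-identityˡ (f (suc k))) (+-mono-≤ (0≤f zero) (term≤∑ (0≤f ∘ suc) k))

  ∑-distrib-- : ∀ {n} (f g : Fin n → Carrier) → ∑ (λ i → f i - g i) ≈ ∑ f - ∑ g
  ∑-distrib-- f g = trans (∑-distrib-+ f (λ i → - g i)) (+-congˡ (∑-neg g))

  χ-diagonal : ∀ {n} (u : Fin n) → χ F u u ≈ 1#
  χ-diagonal u with u ≟ u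
  ... | yes _   = refl
  ... | no u≢u = ⊥-elim (u≢u ≡.refl)

  χ-off-diagonal : ∀ {n} {u i : Fin n} → u ≢ i → χ F u i ≈ 0#
  χ-off-diagonal {u = u} {i} u≢i with u ≟ i
  ... | yes u≡i = ⊥-elim (u≢i u≡i)
  ... | no _    = refl

  χ-nonneg : ∀ {n} (u i : Fin n) → 0# ≤ χ F u i
  χ-nonneg u i with u ≟ i
  ... | yes _ = 0≤1
  ... | no _  = ≤-refl

  ∑-χ* : ∀ {n} (u : Fin n) (f : Fin n → Carrier) → ∑ (λ i → χ F u i * f i) ≈ f u
  ∑-χ* u f = trans
    (∑-concentrated u _ λ i u≢i → trans (*-congʳ (χ-off-diagonal u≢i)) (zeroˡ _))
    (trans (*-congʳ (χ-diagonal u)) (*-identityˡ _))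

  infix 7 _·_
  infixr 8 _*ᵥ_

  _·_ : ∀ {n} → (Fin n → Carrier) → (Fin n → Carrier) → Carrier
  x · y = ∑ (λ i → x i * y i)

  _*ᵥ_ : ∀ {n} → Matrix F n → (Fin n → Carrier) → Fin n → Carrier
  (X *ᵥ x) i = ∑ (λ j → X i j * x j)

  ·-comm : ∀ {n} (x y : Fin n → Carrier) → x · y ≈ y · x
  ·-comm x y = ∑-cong (λ i → *-comm (x i) (y i))

  ·-congˡ : ∀ {n} (x : Fin n → Carrier) {y z : Fin n → Carrier} → (∀ i → y i ≈ z i) → x · y ≈ x · z
  ·-congˡ x y≈z = ∑-cong (λ i → *-congˡ (y≈z i))

  b· : ∀ {n} (u v : Fin n) (x : Fin n → Carrier) → b F u v · x ≈ x u - x v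
  b· u v x = trans
    (∑-cong (λ i → solve 3 (λ χu χv x → (χu :- χv) :* x := χu :* x :- χv :* x) refl (χ F u i) (χ F v i) (x i)))
    (trans (∑-distrib-- _ _) (+-cong (∑-χ* u x) (-‿cong (∑-χ* v x))))

  ∑-b : ∀ {n} (u v : Fin n) → ∑ (b F u v) ≈ 0#
  ∑-b u v = trans (∑-cong (λ i → sym (*-identityʳ _))) (trans (b· u v (λ _ → 1#)) (-‿inverseʳ 1#))

  quad≈·*ᵥ : ∀ {n} (X : Matrix F n) (x : Fin n → Carrier) → quad F X x ≈ x · (X *ᵥ x)
  quad≈·*ᵥ X x = trans (Σ≈∑ _) (∑-cong λ i → trans (Σ≈∑ _)
    (trans (∑-cong (λ j → *-assoc (x i) (X i j) (x j))) (sym (*-distribˡ-∑ (x i) _))))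

module LaplacianProperties {c ℓ₁ ℓ₂} (F : OrderedField c ℓ₁ ℓ₂)
  {n : ℕ} (w : Weights F n) (w-graph : IsWeightedGraph F w) where

  open OrderedField F
  open OrderedFieldProperties F
  open Summation F
  open IntegerCoefficientSolver commutativeRing
  open import Algebra.Properties.Ring ring using (-‿distribʳ-*; -‿involutive; -0#≈0#)
  open ≤-Reasoning

  private
    L : Matrix F n
    L = Laplacian F w

    w-sym : ∀ i j → w i j ≈ w j i
    w-sym = proj₁ w-graph

    w-nonneg : ∀ i j → 0# ≤ w i j
    w-nonneg = proj₂ w-graph

  Laplacian-sym : ∀ i j → L i j ≈ L j i
  Laplacian-sym i j with i ≟ j | j ≟ i
  ... | yes ≡.refl | yes _   = refl
  ... | yes ≡.refl | no j≢j  = ⊥-elim (j≢j ≡.refl)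
  ... | no i≢i     | yes ≡.refl = ⊥-elim (i≢i ≡.refl)
  ... | no _       | no _    = -‿cong (w-sym i j)

  Laplacian-apply : ∀ x i → (L *ᵥ x) i ≈ ∑ (λ j → w i j * (x i - x j))
  Laplacian-apply x i = begin-equality
    (L *ᵥ x) i                                                        ≈⟨ ∑-cong split ⟩
    ∑ (λ j → χ F i j * (deg * x i) + off-diagonal (- w i j * x j))  ≈⟨ ∑-distrib-+ _ _ ⟩
    ∑ (λ j → χ F i j * (deg * x i)) + ∑ (λ j → off-diagonal (- w i j * x j))
      ≈⟨ +-congʳ (trans (∑-χ* i _) (trans (*-congʳ (Σ≈∑ _)) (*-distribʳ-∑ (x i) _))) ⟩
    ∑ (λ j → off-diagonal (w i j) * x i) + ∑ (λ j → off-diagonal (- w i j * x j))  ≈⟨ ∑-distrib-+ _ _ ⟨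
    ∑ (λ j → off-diagonal (w i j) * x i + off-diagonal (- w i j * x j))          ≈⟨ ∑-cong combine ⟩
    ∑ (λ j → w i j * (x i - x j))                                     ∎
    where
    off-diagonal : ∀ {j} → Carrier → Carrier
    off-diagonal {j} z = if ⌊ i ≟ j ⌋ then 0# else z
    deg : Carrier
    deg = Σ F (λ k → off-diagonal {k} (w i k))
    split : ∀ j → L i j * x j ≈ χ F i j * (deg * x i) + off-diagonal {j} (- w i j * x j)
    split j with i ≟ j
    ... | yes ≡.refl = sym (trans (+-identityʳ _) (*-identityˡ _))
    ... | no _       = sym (trans (+-congʳ (zeroˡ _)) (+-identityˡ _))
    combine : ∀ j → off-diagonal {j} (w i j) * x i + off-diagonal {j} (- w i j * x j) ≈ w i j * (x i - x j)
    combine j with i ≟ j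
    ... | yes ≡.refl = trans (trans (+-identityʳ _) (zeroˡ _)) (sym (trans (*-congˡ (-‿inverseʳ (x i))) (zeroʳ _)))
    ... | no _       = solve 3 (λ w x y → w :* x :+ :- w :* y := w :* (x :- y)) refl (w i j) (x i) (x j)

  -- Summed over ordered pairs: twice the usual ∑ over edges of w (x i − x j) (y i − y j).
  energy : (Fin n → Carrier) → (Fin n → Carrier) → Carrier
  energy x y = ∑ (λ i → ∑ (λ j → w i j * ((x i - x j) * (y i - y j))))

  energy-cong : ∀ {x x′ y y′} → (∀ i → x i ≈ x′ i) → (∀ i → y i ≈ y′ i) → energy x y ≈ energy x′ y′
  energy-cong x≈x′ y≈y′ = ∑-cong (λ i → ∑-cong (λ j →
    *-congˡ (*-cong (+-cong (x≈x′ i) (-‿cong (x≈x′ j))) (+-cong (y≈y′ i) (-‿cong (y≈y′ j))))))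

  energy-comm : ∀ x y → energy x y ≈ energy y x
  energy-comm x y = ∑-cong (λ i → ∑-cong (λ j → *-congˡ (*-comm _ _)))

  energy-nonneg : ∀ x → 0# ≤ energy x x
  energy-nonneg x = ∑-nonneg (λ i → ∑-nonneg (λ j → *-nonneg (w-nonneg i j) (x*x-nonneg _)))

  energy≈2·Laplacian : ∀ x y → energy x y ≈ x · (L *ᵥ y) + x · (L *ᵥ y)
  energy≈2·Laplacian x y = sym (begin-equality
    x · (L *ᵥ y) + x · (L *ᵥ y)                          ≈⟨ +-cong from-i (trans from-i swap) ⟩
    ∑ (λ i → ∑ (λ j → term i j)) + ∑ (λ i → ∑ (λ j → term′ i j))  ≈⟨ ∑-distrib-+ _ _ ⟨
    ∑ (λ i → ∑ (λ j → term i j) + ∑ (λ j → term′ i j))   ≈⟨ ∑-cong (λ i → ∑-distrib-+ _ _) ⟨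
    ∑ (λ i → ∑ (λ j → term i j + term′ i j))            ≈⟨ ∑-cong (λ i → ∑-cong (λ j →
      solve 5 (λ xi xj w yi yj → xi :* (w :* (yi :- yj)) :+ xj :* (w :* (yj :- yi)) := w :* ((xi :- xj) :* (yi :- yj)))
              refl (x i) (x j) (w i j) (y i) (y j))) ⟩
    energy x y                                           ∎)
    where
    term term′ : Fin n → Fin n → Carrier
    term  i j = x i * (w i j * (y i - y j))
    term′ i j = x j * (w i j * (y j - y i))
    from-i : x · (L *ᵥ y) ≈ ∑ (λ i → ∑ (λ j → term i j))
    from-i = ∑-cong (λ i → trans (*-congˡ (Laplacian-apply y i)) (*-distribˡ-∑ (x i) _))
    swap : ∑ (λ i → ∑ (λ j → term i j)) ≈ ∑ (λ i → ∑ (λ j → term′ i j))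
    swap = trans (∑-comm _) (∑-cong (λ i → ∑-cong (λ j → *-congˡ (*-congʳ (w-sym j i)))))

  energy-AM-GM : ∀ x y → energy x y + energy x y ≤ energy x x + energy y y
  energy-AM-GM x y = 0≤d≈y-x⇒x≤y (begin-equality
    ∑ (λ i → ∑ (λ j → w i j * (Δ i j * Δ i j)))  ≈⟨ ∑-cong (λ i → ∑-cong (λ j → expand i j)) ⟩
    ∑ (λ i → ∑ (λ j → (square x i j + square y i j) - (cross i j + cross i j)))
      ≈⟨ trans (∑-cong (λ i → ∑-distrib-- _ _)) (∑-distrib-- _ _) ⟩
    ∑ (λ i → ∑ (λ j → square x i j + square y i j)) - ∑ (λ i → ∑ (λ j → cross i j + cross i j))
      ≈⟨ +-cong (trans (∑-cong (λ i → ∑-distrib-+ _ _)) (∑-distrib-+ _ _))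
                (-‿cong (trans (∑-cong (λ i → ∑-distrib-+ _ _)) (∑-distrib-+ _ _))) ⟩
    (energy x x + energy y y) - (energy x y + energy x y)  ∎)
    (∑-nonneg (λ i → ∑-nonneg (λ j → *-nonneg (w-nonneg i j) (x*x-nonneg (Δ i j)))))
    where
    Δ : Fin n → Fin n → Carrier
    Δ i j = (x i - x j) - (y i - y j)
    square : (Fin n → Carrier) → Fin n → Fin n → Carrier
    square z i j = w i j * ((z i - z j) * (z i - z j))
    cross : Fin n → Fin n → Carrier
    cross i j = w i j * ((x i - x j) * (y i - y j))
    expand : ∀ i j → w i j * (Δ i j * Δ i j) ≈ (square x i j + square y i j) - (cross i j + cross i j)
    expand i j = solve 5 (λ w a b c d →
      w :* (((a :- b) :- (c :- d)) :* ((a :- b) :- (c :- d)))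
        := (w :* ((a :- b) :* (a :- b)) :+ w :* ((c :- d) :* (c :- d))) :- (w :* ((a :- b) :* (c :- d)) :+ w :* ((a :- b) :* (c :- d))))
      refl (w i j) (x i) (x j) (y i) (y j)

  energy-clamp≤ : ∀ l h x → energy (clamp l h ∘ x) (clamp l h ∘ x) ≤ energy x x
  energy-clamp≤ l h x = ∑-mono-≤ (λ i → ∑-mono-≤ (λ j →
    *-monoˡ-≤-nonneg (w i j) (w-nonneg i j) (clamp-contracts-squares l h (x i) (x j))))

  ·Laplacian-sym : ∀ x y → x · (L *ᵥ y) ≈ y · (L *ᵥ x)
  ·Laplacian-sym x y = begin-equality
    ∑ (λ i → x i * ∑ (λ j → L i j * y j))   ≈⟨ ∑-cong (λ i → *-distribˡ-∑ (x i) _) ⟩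
    ∑ (λ i → ∑ (λ j → x i * (L i j * y j)))  ≈⟨ ∑-comm _ ⟩
    ∑ (λ j → ∑ (λ i → x i * (L i j * y j)))  ≈⟨ ∑-cong (λ j → ∑-cong (λ i →
      trans (*-congˡ (*-congʳ (Laplacian-sym i j))) (solve 3 (λ a l b → a :* (l :* b) := b :* (l :* a)) refl (x i) (L j i) (y j)))) ⟩
    ∑ (λ j → ∑ (λ i → y j * (L j i * x i)))  ≈⟨ ∑-cong (λ j → *-distribˡ-∑ (y j) _) ⟨
    ∑ (λ j → y j * ∑ (λ i → L j i * x i))   ∎

  module _ (connected : Connected F w) where

    -- The set of maximisers of a function that is subharmonic off p is closed
    -- under edges leaving vertices other than p; connectivity carries it to p.
    maximum-principle : ∀ x p → (∀ j → j ≢ p → (L *ᵥ x) j ≤ 0#) → ∀ k → x k ≤ x p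
    maximum-principle x p subharmonic k = ≤-respʳ (sym x[p]≈max) (≤max k)
      where
      open import Data.List.Extrema ≤-totalOrder using (argmax; f[xs]≤f[argmax])
      m : Fin n
      m = argmax x p (allFin n)
      ≤max : ∀ k → x k ≤ x m
      ≤max k = All.lookup (f[xs]≤f[argmax] p (allFin n)) (∈-allFin k)
      spread : ∀ {j k} → x j ≈ x m → (L *ᵥ x) j ≤ 0# → 0# < w j k → x k ≈ x m
      spread {j} {k} x[j]≈max Lx≤0 (_ , w≉0) = trans (sym x[j]≈x[k]) x[j]≈max
        where
        drop : Fin n → Carrier
        drop k′ = w j k′ * (x j - x k′)
        drop-nonneg : ∀ k′ → 0# ≤ drop k′
        drop-nonneg k′ = *-nonneg (w-nonneg j k′) (x≤y⇒0≤y-x (≤-respʳ (sym x[j]≈max) (≤max k′)))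
        drop≈0 : drop k ≈ 0#
        drop≈0 = antisym (≤-trans (term≤∑ drop-nonneg k) (≤-respˡ (Laplacian-apply x j) Lx≤0)) (drop-nonneg k)
        x[j]≈x[k] : x j ≈ x k
        x[j]≈x[k] = trans (solve 2 (λ a b → a := (a :- b) :+ b) refl (x j) (x k))
          (trans (+-congʳ (x*y≈0⇒y≈0 (λ w≈0 → w≉0 (sym w≈0)) drop≈0)) (+-identityˡ _))
      max-until-p : ∀ {j} → Reachable F w m j → x j ≈ x m ⊎ x p ≈ x m
      max-until-p here = inj₁ refl
      max-until-p (step {j} r edge) with max-until-p r
      ... | inj₂ x[p]≈max = inj₂ x[p]≈max
      ... | inj₁ x[j]≈max with j ≟ p
      ...   | yes ≡.refl = inj₂ x[j]≈max
      ...   | no j≢p     = inj₁ (spread x[j]≈max (subharmonic j j≢p) edge)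
      x[p]≈max : x p ≈ x m
      x[p]≈max with max-until-p (connected m p)
      ... | inj₁ e = e
      ... | inj₂ e = e

    minimum-principle : ∀ x q → (∀ j → j ≢ q → 0# ≤ (L *ᵥ x) j) → ∀ k → x q ≤ x k
    minimum-principle x q superharmonic k = ≤-respˡ (-‿involutive _) (≤-respʳ (-‿involutive _)
      (-‿antimono-≤ (maximum-principle (λ i → - x i) q subharmonic k)))
      where
      L*ᵥ-neg : ∀ j → (L *ᵥ (λ i → - x i)) j ≈ - (L *ᵥ x) j
      L*ᵥ-neg j = trans (∑-cong (λ i → sym (-‿distribʳ-* _ _))) (∑-neg _)
      subharmonic : ∀ j → j ≢ q → (L *ᵥ (λ i → - x i)) j ≤ 0#
      subharmonic j j≢q = ≤-respˡ (sym (L*ᵥ-neg j)) (≤-respʳ -0#≈0# (-‿antimono-≤ (superharmonic j j≢q)))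

    harmonic⇒constant : ∀ x → (∀ i → (L *ᵥ x) i ≈ 0#) → ∀ i j → x i ≈ x j
    harmonic⇒constant x harmonic i j = antisym
      (maximum-principle x j (λ k _ → ≤-reflexive (harmonic k)) i)
      (maximum-principle x i (λ k _ → ≤-reflexive (harmonic k)) j)

    -- Row r of I − L X is killed by L (first Penrose equation), so it is a
    -- constant vector, which is orthogonal to β.
    pseudoinverse-solves : ∀ {X} → IsPseudoinverse F L X → ∀ β → ∑ β ≈ 0# → ∀ r → (L *ᵥ (X *ᵥ β)) r ≈ β r
    pseudoinverse-solves {X} (LXL≈L , _) β ∑β≈0 r = begin-equality
      (L *ᵥ (X *ᵥ β)) r                  ≈⟨ ∑-cong (λ k → *-distribˡ-∑ (L r k) _) ⟩
      ∑ (λ k → ∑ (λ j → L r k * (X k j * β j)))  ≈⟨ ∑-comm _ ⟩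
      ∑ (λ j → ∑ (λ k → L r k * (X k j * β j)))
        ≈⟨ ∑-cong (λ j → trans (∑-cong (λ k → sym (*-assoc _ _ _))) (sym (*-distribʳ-∑ (β j) _))) ⟩
      ∑ (λ j → LX j * β j)
        ≈⟨ ∑-cong (λ j → solve 3 (λ χ p b → p :* b := χ :* b :- (χ :- p) :* b) refl (χ F r j) (LX j) (β j)) ⟩
      ∑ (λ j → χ F r j * β j - q j * β j)  ≈⟨ ∑-distrib-- _ _ ⟩
      ∑ (λ j → χ F r j * β j) - ∑ (λ j → q j * β j)  ≈⟨ +-cong (∑-χ* r β) (-‿cong q·β≈0) ⟩
      β r - 0#                            ≈⟨ trans (+-congˡ -0#≈0#) (+-identityʳ _) ⟩
      β r                                 ∎
      where
      LX : Fin n → Carrier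
      LX j = ∑ (λ k → L r k * X k j)
      q : Fin n → Carrier
      q j = χ F r j - LX j
      [LX]L≈L : ∀ i → ∑ (λ j → LX j * L j i) ≈ L r i
      [LX]L≈L i = trans (∑-cong (λ j → *-congʳ (sym (Σ≈∑ _)))) (trans (sym (Σ≈∑ _)) (LXL≈L r i))
      Lq≈0 : ∀ i → (L *ᵥ q) i ≈ 0#
      Lq≈0 i = begin-equality
        ∑ (λ j → L i j * q j)              ≈⟨ ∑-cong (λ j → trans (*-congʳ (Laplacian-sym i j)) (*-comm _ _)) ⟩
        ∑ (λ j → q j * L j i)
          ≈⟨ ∑-cong (λ j → solve 3 (λ χ p l → (χ :- p) :* l := χ :* l :- p :* l) refl (χ F r j) (LX j) (L j i)) ⟩
        ∑ (λ j → χ F r j * L j i - LX j * L j i)  ≈⟨ ∑-distrib-- _ _ ⟩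
        ∑ (λ j → χ F r j * L j i) - ∑ (λ j → LX j * L j i)
          ≈⟨ +-cong (∑-χ* r (λ j → L j i)) (-‿cong ([LX]L≈L i)) ⟩
        L r i - L r i                      ≈⟨ -‿inverseʳ _ ⟩
        0#                                 ∎
      q·β≈0 : ∑ (λ j → q j * β j) ≈ 0#
      q·β≈0 = trans (∑-cong (λ j → *-congʳ (harmonic⇒constant q Lq≈0 j r)))
        (trans (sym (*-distribˡ-∑ (q r) β)) (trans (*-congˡ ∑β≈0) (zeroʳ _)))

    module Potentials {X : Matrix F n} (X-pinv : IsPseudoinverse F L X) where

      potential : Fin n → Fin n → Fin n → Carrier
      potential p q = X *ᵥ b F p q

      Laplacian-potential : ∀ p q r → (L *ᵥ potential p q) r ≈ b F p q r
      Laplacian-potential p q = pseudoinverse-solves X-pinv (b F p q) (∑-b p q)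

      ·Laplacian-potential : ∀ x p q → x · (L *ᵥ potential p q) ≈ x p - x q
      ·Laplacian-potential x p q =
        trans (·-congˡ x (Laplacian-potential p q)) (trans (·-comm x _) (b· p q x))

      Reff≈potential-drop : ∀ p q → Reff F X p q ≈ potential p q p - potential p q q
      Reff≈potential-drop p q = trans (quad≈·*ᵥ X (b F p q)) (b· p q (potential p q))

      Reff-refl : ∀ p → Reff F X p p ≈ 0#
      Reff-refl p = trans (Reff≈potential-drop p p) (-‿inverseʳ _)

      potential-reciprocity : ∀ p q x z → potential p q x - potential p q z ≈ potential x z p - potential x z q
      potential-reciprocity p q x z = begin-equality
        potential p q x - potential p q z     ≈⟨ ·Laplacian-potential (potential p q) x z ⟨
        potential p q · (L *ᵥ potential x z)  ≈⟨ ·Laplacian-sym (potential p q) (potential x z) ⟩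
        potential x z · (L *ᵥ potential p q)  ≈⟨ ·Laplacian-potential (potential x z) p q ⟩
        potential x z p - potential x z q     ∎

      potential≤source : ∀ p q k → potential p q k ≤ potential p q p
      potential≤source p q = maximum-principle (potential p q) p λ j j≢p →
        ≤-respˡ (sym (Laplacian-potential p q j))
          (≤-respˡ (sym (trans (+-congʳ (χ-off-diagonal (j≢p ∘ ≡.sym))) (+-identityˡ _)))
            (≤-respʳ -0#≈0# (-‿antimono-≤ (χ-nonneg q j))))

      sink≤potential : ∀ p q k → potential p q q ≤ potential p q k
      sink≤potential p q = minimum-principle (potential p q) q λ j j≢q →
        ≤-respʳ (sym (Laplacian-potential p q j))
          (≤-respʳ (sym (trans (+-congˡ (trans (-‿cong (χ-off-diagonal (j≢q ∘ ≡.sym))) -0#≈0#)) (+-identityʳ _)))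
            (χ-nonneg p j))

      potential-drop≤Reff : ∀ p q x → potential p q p - potential p q x ≤ Reff F X p x
      potential-drop≤Reff p q x = begin
        potential p q p - potential p q x  ≈⟨ potential-reciprocity p q p x ⟩
        potential p x p - potential p x q  ≤⟨ +-monoʳ-≤ _ (-‿antimono-≤ (sink≤potential p x q)) ⟩
        potential p x p - potential p x x  ≈⟨ Reff≈potential-drop p x ⟨
        Reff F X p x                       ∎

      potential-rise≤Reff : ∀ p q y → potential p q y - potential p q q ≤ Reff F X y q
      potential-rise≤Reff p q y = begin
        potential p q y - potential p q q  ≈⟨ potential-reciprocity p q y q ⟩
        potential y q p - potential y q q  ≤⟨ +-monoˡ-≤ _ (potential≤source y q p) ⟩
        potential y q y - potential y q q  ≈⟨ Reff≈potential-drop y q ⟨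
        Reff F X y q                       ∎

      energy-potential : ∀ p q → energy (potential p q) (potential p q) ≈ Reff F X p q + Reff F X p q
      energy-potential p q = trans (energy≈2·Laplacian _ _) (+-cong Reff≈ Reff≈)
        where
        Reff≈ : potential p q · (L *ᵥ potential p q) ≈ Reff F X p q
        Reff≈ = trans (·Laplacian-potential (potential p q) p q) (sym (Reff≈potential-drop p q))

      Reff-nonneg : ∀ p q → 0# ≤ Reff F X p q
      Reff-nonneg p q = x+x≤y+y⇒x≤y
        (≤-respˡ (sym (+-identityʳ 0#)) (≤-respʳ (energy-potential p q) (energy-nonneg (potential p q))))

      -- Division-free Dirichlet principle: the AM–GM inequality for the energy
      -- form, applied to x and the potential from p to q.
      Dirichlet-bound : ∀ p q x → let d = x p - x q in
        (d + d) + (d + d) ≤ (Reff F X p q + Reff F X p q) + energy x x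
      Dirichlet-bound p q x = begin
        (d + d) + (d + d)                                     ≈⟨ +-cong cross cross ⟨
        energy ψ x + energy ψ x                               ≤⟨ energy-AM-GM ψ x ⟩
        energy ψ ψ + energy x x                               ≈⟨ +-congʳ (energy-potential p q) ⟩
        (Reff F X p q + Reff F X p q) + energy x x            ∎
        where
        d : Carrier
        d = x p - x q
        ψ : Fin n → Carrier
        ψ = potential p q
        cross : energy ψ x ≈ d + d
        cross = trans (energy-comm ψ x) (trans (energy≈2·Laplacian x ψ)
          (+-cong (·Laplacian-potential x p q) (·Laplacian-potential x p q)))

module ContractionProperties {c ℓ₁ ℓ₂} (F : OrderedField c ℓ₁ ℓ₂)
  {n m : ℕ} (w : Weights F n) (w-graph : IsWeightedGraph F w) (π : Fin n → Fin m) where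

  open OrderedField F
  open OrderedFieldProperties F
  open Summation F
  open ≤-Reasoning

  private
    w′ : Weights F m
    w′ = Contract F w π

    fibre : Fin m → Fin m → Fin n → Fin n → Carrier
    fibre a a′ i j = if ⌊ π i ≟ a ⌋ ∧ ⌊ π j ≟ a′ ⌋ then w i j else 0#

    w′≈ : ∀ a a′ → w′ a a′ ≈ ∑ (λ i → ∑ (λ j → fibre a a′ i j))
    w′≈ a a′ = trans (Σ≈∑ _) (∑-cong (λ i → Σ≈∑ _))

    fibre-sym : ∀ a a′ i j → fibre a a′ i j ≈ fibre a′ a j i
    fibre-sym a a′ i j with π i ≟ a | π j ≟ a′
    ... | yes _ | yes _ = proj₁ w-graph i j
    ... | yes _ | no _  = refl
    ... | no _  | yes _ = refl
    ... | no _  | no _  = refl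

    fibre-nonneg : ∀ a a′ i j → 0# ≤ fibre a a′ i j
    fibre-nonneg a a′ i j with π i ≟ a | π j ≟ a′
    ... | yes _ | yes _ = proj₂ w-graph i j
    ... | yes _ | no _  = ≤-refl
    ... | no _  | yes _ = ≤-refl
    ... | no _  | no _  = ≤-refl

    fibre-π : ∀ i j → fibre (π i) (π j) i j ≈ w i j
    fibre-π i j with π i ≟ π i | π j ≟ π j
    ... | yes _ | yes _   = refl
    ... | yes _ | no πj≢πj = ⊥-elim (πj≢πj ≡.refl)
    ... | no πi≢πi | _     = ⊥-elim (πi≢πi ≡.refl)

    fibre-offˡ : ∀ {a a′ i} j → π i ≢ a → fibre a a′ i j ≈ 0#
    fibre-offˡ {a} {i = i} j πi≢a with π i ≟ a
    ... | yes πi≡a = ⊥-elim (πi≢a πi≡a)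
    ... | no _     = refl

    fibre-offʳ : ∀ {a′ j} a i → π j ≢ a′ → fibre a a′ i j ≈ 0#
    fibre-offʳ {a′} {j} a i πj≢a′ with π i ≟ a | π j ≟ a′
    ... | _     | yes πj≡a′ = ⊥-elim (πj≢a′ πj≡a′)
    ... | yes _ | no _      = refl
    ... | no _  | no _      = refl

  Contract-isWeightedGraph : IsWeightedGraph F w′
  Contract-isWeightedGraph =
    (λ a a′ → trans (w′≈ a a′) (trans (∑-comm _) (trans (∑-cong (λ i → ∑-cong (λ j → fibre-sym a a′ j i))) (sym (w′≈ a′ a)))))
    , (λ a a′ → ≤-respʳ (sym (w′≈ a a′)) (∑-nonneg (λ i → ∑-nonneg (λ j → fibre-nonneg a a′ i j))))

  w≤Contract : ∀ i j → w i j ≤ w′ (π i) (π j)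
  w≤Contract i j = begin
    w i j                                            ≈⟨ fibre-π i j ⟨
    fibre (π i) (π j) i j                            ≤⟨ term≤∑ (fibre-nonneg (π i) (π j) i) j ⟩
    ∑ (λ j′ → fibre (π i) (π j) i j′)                ≤⟨ term≤∑ (λ i′ → ∑-nonneg (fibre-nonneg (π i) (π j) i′)) i ⟩
    ∑ (λ i′ → ∑ (λ j′ → fibre (π i) (π j) i′ j′))    ≈⟨ w′≈ (π i) (π j) ⟨
    w′ (π i) (π j)                                   ∎

  Reachable-Contract : ∀ {i j} → Reachable F w i j → Reachable F w′ (π i) (π j)
  Reachable-Contract here = here
  Reachable-Contract (step {j} {k} r (0≤w , 0≉w)) = step (Reachable-Contract r)
    (proj₂ Contract-isWeightedGraph (π j) (π k) , λ 0≈w′ → 0≉w (antisym 0≤w (≤-respʳ (sym 0≈w′) (w≤Contract j k))))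

  Contract-connected : Surjective _≡_ _≡_ π → Connected F w → Connected F w′
  Contract-connected π-onto connected a a′ with π-onto a | π-onto a′
  ... | i , πi≡a | j , πj≡a′ = ≡.subst₂ (Reachable F w′) (πi≡a ≡.refl) (πj≡a′ ≡.refl) (Reachable-Contract (connected i j))

  open LaplacianProperties F w w-graph using (energy)
  open LaplacianProperties F w′ Contract-isWeightedGraph public using () renaming (energy to energy′)

  energy-Contract : ∀ x y → energy′ x y ≈ energy (x ∘ π) (y ∘ π)
  energy-Contract x y = begin-equality
    ∑ (λ a → ∑ (λ a′ → w′ a a′ * S a a′))                             ≈⟨ ∑-cong (λ a → ∑-cong (λ a′ → expand a a′)) ⟩
    ∑ (λ a → ∑ (λ a′ → ∑ (λ i → ∑ (λ j → fibre a a′ i j * S a a′))))  ≈⟨ ∑-cong (λ a → ∑-comm _) ⟩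
    ∑ (λ a → ∑ (λ i → ∑ (λ a′ → ∑ (λ j → fibre a a′ i j * S a a′))))  ≈⟨ ∑-comm _ ⟩
    ∑ (λ i → ∑ (λ a → ∑ (λ a′ → ∑ (λ j → fibre a a′ i j * S a a′))))  ≈⟨ ∑-cong (λ i → ∑-cong (λ a → ∑-comm _)) ⟩
    ∑ (λ i → ∑ (λ a → ∑ (λ j → ∑ (λ a′ → fibre a a′ i j * S a a′))))  ≈⟨ ∑-cong (λ i → ∑-comm _) ⟩
    ∑ (λ i → ∑ (λ j → ∑ (λ a → ∑ (λ a′ → fibre a a′ i j * S a a′))))  ≈⟨ ∑-cong (λ i → ∑-cong (λ j → select i j)) ⟩
    ∑ (λ i → ∑ (λ j → w i j * S (π i) (π j)))                         ∎
    where
    S : Fin m → Fin m → Carrier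
    S a a′ = (x a - x a′) * (y a - y a′)
    expand : ∀ a a′ → w′ a a′ * S a a′ ≈ ∑ (λ i → ∑ (λ j → fibre a a′ i j * S a a′))
    expand a a′ = trans (*-congʳ (w′≈ a a′))
      (trans (*-distribʳ-∑ _ _) (∑-cong (λ i → *-distribʳ-∑ _ _)))
    select : ∀ i j → ∑ (λ a → ∑ (λ a′ → fibre a a′ i j * S a a′)) ≈ w i j * S (π i) (π j)
    select i j = trans
      (∑-concentrated (π i) _ λ a πi≢a → ∑-zero (λ a′ → trans (*-congʳ (fibre-offˡ j πi≢a)) (zeroˡ _)))
      (trans (∑-concentrated (π j) _ λ a′ πj≢a′ → trans (*-congʳ (fibre-offʳ (π i) i πj≢a′)) (zeroˡ _))
             (*-congʳ (fibre-π i j)))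

module IdentificationProperties {c ℓ₁ ℓ₂} (F : OrderedField c ℓ₁ ℓ₂)
  {n m : ℕ} (w : Weights F n) (w-graph : IsWeightedGraph F w)
  {C₁ C₂ : Subset n} {π : Fin n → Fin m} {s t : Fin m} (π-identifies : IsIdentification C₁ C₂ π s t) where

  open OrderedField F
  open OrderedFieldProperties F
  open ContractionProperties F w w-graph π
  open LaplacianProperties F w w-graph using (energy; energy-cong)
  open ≤-Reasoning

  private
    π-onto : Surjective _≡_ _≡_ π
    π-onto = proj₁ π-identifies

    ∈C₁⇒π≡s : ∀ {i} → i ∈ C₁ → π i ≡ s
    ∈C₁⇒π≡s = proj₁ (proj₁ (proj₂ π-identifies) _)

    π≡s⇒∈C₁ : ∀ {i} → π i ≡ s → i ∈ C₁
    π≡s⇒∈C₁ = proj₂ (proj₁ (proj₂ π-identifies) _)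

    ∈C₂⇒π≡t : ∀ {i} → i ∈ C₂ → π i ≡ t
    ∈C₂⇒π≡t = proj₁ (proj₁ (proj₂ (proj₂ π-identifies)) _)

    π≡t⇒∈C₂ : ∀ {i} → π i ≡ t → i ∈ C₂
    π≡t⇒∈C₂ = proj₂ (proj₁ (proj₂ (proj₂ π-identifies)) _)

    π-injective-outside : ∀ i j → i ∉ C₁ → i ∉ C₂ → π i ≡ π j → i ≡ j
    π-injective-outside = proj₂ (proj₂ (proj₂ π-identifies))

  contracted-connected : Connected F w → Connected F (Contract F w π)
  contracted-connected = Contract-connected π-onto

  section : Fin m → Fin n
  section a = proj₁ (π-onto a)

  π∘section : ∀ a → π (section a) ≡ a
  π∘section a = proj₂ (π-onto a) ≡.refl

  section-s∈C₁ : section s ∈ C₁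
  section-s∈C₁ = π≡s⇒∈C₁ (π∘section s)

  section-t∈C₂ : section t ∈ C₂
  section-t∈C₂ = π≡t⇒∈C₂ (π∘section t)

  section∘π∈C₁ : ∀ {i} → i ∈ C₁ → section (π i) ∈ C₁
  section∘π∈C₁ i∈C₁ = π≡s⇒∈C₁ (≡.trans (π∘section _) (∈C₁⇒π≡s i∈C₁))

  section∘π∈C₂ : ∀ {i} → i ∈ C₂ → section (π i) ∈ C₂
  section∘π∈C₂ i∈C₂ = π≡t⇒∈C₂ (≡.trans (π∘section _) (∈C₂⇒π≡t i∈C₂))

  section∘π-outside : ∀ {i} → i ∉ C₁ → i ∉ C₂ → section (π i) ≡ i
  section∘π-outside {i} i∉C₁ i∉C₂ = ≡.sym (π-injective-outside i _ i∉C₁ i∉C₂ (≡.sym (π∘section (π i))))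

  module _ (x : Fin n → Carrier) {α β : Carrier}
           (x≈α : ∀ i → i ∈ C₁ → x i ≈ α) (x≈β : ∀ i → i ∈ C₂ → x i ≈ β) where

    descend : ∀ i → x (section (π i)) ≈ x i
    descend i with i ∈? C₁ | i ∈? C₂
    ... | yes i∈C₁ | _        = trans (x≈α _ (section∘π∈C₁ i∈C₁)) (sym (x≈α i i∈C₁))
    ... | no _     | yes i∈C₂ = trans (x≈β _ (section∘π∈C₂ i∈C₂)) (sym (x≈β i i∈C₂))
    ... | no i∉C₁  | no i∉C₂  = reflexive (≡.cong x (section∘π-outside i∉C₁ i∉C₂))

    test-function-bound : Connected F w → ∀ {XJ} → IsPseudoinverse F (Laplacian F (Contract F w π)) XJ →
      let d = α - β in (d + d) + (d + d) ≤ (Reff F XJ s t + Reff F XJ s t) + energy x x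
    test-function-bound connected XJ-pinv = begin
      (d + d) + (d + d)                          ≈⟨ +-cong (+-cong φ-gap φ-gap) (+-cong φ-gap φ-gap) ⟨
      (d′ + d′) + (d′ + d′)                      ≤⟨ J.Dirichlet-bound s t φ ⟩
      (Reff F _ s t + Reff F _ s t) + energy′ φ φ  ≈⟨ +-congˡ (trans (energy-Contract φ φ) (energy-cong descend descend)) ⟩
      (Reff F _ s t + Reff F _ s t) + energy x x   ∎
      where
      module J = LaplacianProperties.Potentials F (Contract F w π) Contract-isWeightedGraph
                   (contracted-connected connected) XJ-pinv
      φ : Fin m → Carrier
      φ = x ∘ section
      d d′ : Carrier
      d = α - β
      d′ = φ s - φ t
      φ-gap : d′ ≈ d
      φ-gap = +-cong (x≈α _ section-s∈C₁) (-‿cong (x≈β _ section-t∈C₂))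

module ClusterContraction {c ℓ₁ ℓ₂} (F : OrderedField c ℓ₁ ℓ₂) where

  open OrderedField F
  open OrderedFieldProperties F
  open IntegerCoefficientSolver commutativeRing
  open import Algebra.Properties.Ring ring using (-0#≈0#)
  open ≤-Reasoning

  module _
    {n : ℕ} {w : Weights F n} (w-graph : IsWeightedGraph F w) (connected : Connected F w)
    {C₁ C₂ : Subset n} {R : Carrier}
    {XI : Matrix F n} (XI-pinv : IsPseudoinverse F (Laplacian F w) XI)
    (diam₁ : ∀ u v → u ∈ C₁ → v ∈ C₁ → Reff F XI u v ≤ R)
    (diam₂ : ∀ u v → u ∈ C₂ → v ∈ C₂ → Reff F XI u v ≤ R)
    {m : ℕ} {π : Fin n → Fin m} {s t : Fin m} (π-identifies : IsIdentification C₁ C₂ π s t)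
    {XJ : Matrix F m} (XJ-pinv : IsPseudoinverse F (Laplacian F (Contract F w π)) XJ) where

    open LaplacianProperties F w w-graph
    open Potentials connected XI-pinv
    open IdentificationProperties F w w-graph π-identifies

    open ContractionProperties F w w-graph π using (Contract-isWeightedGraph)

    private
      module J = LaplacianProperties.Potentials F (Contract F w π) Contract-isWeightedGraph
                   (contracted-connected connected) XJ-pinv

      gap-arithmetic : ∀ D R → let d = D - (R + R) ; D′ = D - (R + R + R + R) in
        (D′ + D′) + (D + D) ≈ (d + d) + (d + d)
      gap-arithmetic = solve 2 (λ D R →
        ((D :- (R :+ R :+ R :+ R)) :+ (D :- (R :+ R :+ R :+ R))) :+ (D :+ D)
          := ((D :- (R :+ R)) :+ (D :- (R :+ R))) :+ ((D :- (R :+ R)) :+ (D :- (R :+ R)))) refl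

    Reff-Contract≥Reff-4R : ∀ {u v} → u ∈ C₁ → v ∈ C₂ → Reff F XI u v - (R + R + R + R) ≤ Reff F XJ s t
    Reff-Contract≥Reff-4R {u} {v} u∈C₁ v∈C₂ = [ far , near ]′ (total (R + R) D)
      where
      D : Carrier
      D = Reff F XI u v
      ψ : Fin n → Carrier
      ψ = potential u v
      hi lo : Carrier
      hi = ψ u - R
      lo = ψ v + R
      D≈ : D ≈ ψ u - ψ v
      D≈ = Reff≈potential-drop u v

      near : D ≤ R + R → D - (R + R + R + R) ≤ Reff F XJ s t
      near D≤2R = begin
        D - (R + R + R + R)             ≤⟨ +-monoˡ-≤ _ D≤2R ⟩
        (R + R) - (R + R + R + R)       ≈⟨ solve 1 (λ R → (R :+ R) :- (R :+ R :+ R :+ R) := :- (R :+ R)) refl R ⟩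
        - (R + R)                       ≤⟨ ≤-respʳ -0#≈0# (-‿antimono-≤ (+-nonneg R-nonneg R-nonneg)) ⟩
        0#                              ≤⟨ J.Reff-nonneg s t ⟩
        Reff F XJ s t                   ∎
        where
        R-nonneg : 0# ≤ R
        R-nonneg = ≤-respˡ (Reff-refl u) (diam₁ u u u∈C₁ u∈C₁)

      far : R + R ≤ D → D - (R + R + R + R) ≤ Reff F XJ s t
      far 2R≤D = x+x≤y+y⇒x≤y (+-cancelʳ-≤ (D + D) (begin
        (D′ + D′) + (D + D)                          ≈⟨ gap-arithmetic D R ⟩
        (D - (R + R) + (D - (R + R))) + (D - (R + R) + (D - (R + R)))
                                                     ≈⟨ +-cong (+-cong hi-lo hi-lo) (+-cong hi-lo hi-lo) ⟨
        ((hi - lo) + (hi - lo)) + ((hi - lo) + (hi - lo))  ≤⟨ test-function-bound x x≈hi x≈lo connected XJ-pinv ⟩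
        (Reff F XJ s t + Reff F XJ s t) + energy x x   ≤⟨ +-monoʳ-≤ _ (energy-clamp≤ lo hi ψ) ⟩
        (Reff F XJ s t + Reff F XJ s t) + energy ψ ψ   ≈⟨ +-congˡ (energy-potential u v) ⟩
        (Reff F XJ s t + Reff F XJ s t) + (D + D)      ∎))
        where
        D′ : Carrier
        D′ = D - (R + R + R + R)
        hi-lo : hi - lo ≈ D - (R + R)
        hi-lo = trans (solve 3 (λ a b R → (a :- R) :- (b :+ R) := (a :- b) :- (R :+ R)) refl (ψ u) (ψ v) R)
                      (+-congʳ (sym D≈))
        lo≤hi : lo ≤ hi
        lo≤hi = 0≤d≈y-x⇒x≤y (solve 3 (λ a b R → (a :- b) :- (R :+ R) := (a :- R) :- (b :+ R)) refl (ψ u) (ψ v) R)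
                  (x≤y⇒0≤y-x (≤-respʳ D≈ 2R≤D))
        x : Fin n → Carrier
        x = clamp lo hi ∘ ψ
        x≈hi : ∀ i → i ∈ C₁ → x i ≈ hi
        x≈hi i i∈C₁ = clamp≈upper lo hi lo≤hi
          (x-y≤z⇒x-z≤y (≤-trans (potential-drop≤Reff u v i) (diam₁ u i u∈C₁ i∈C₁)))
        x≈lo : ∀ i → i ∈ C₂ → x i ≈ lo
        x≈lo i i∈C₂ = clamp≈lower lo hi
          (x-y≤z⇒x≤y+z (≤-trans (potential-rise≤Reff u v i) (diam₂ i v i∈C₂ v∈C₂)))

mainTheorem13 : ∀ {c ℓ₁ ℓ₂} (F : OrderedField c ℓ₁ ℓ₂) →
    let open OrderedField F in
    (n : ℕ) (w : Weights F n) → IsWeightedGraph F w → Connected F w →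
    (C₁ C₂ : Subset n) (R γ : Carrier) → 4# < γ →
    (XI : Matrix F n) → IsPseudoinverse F (Laplacian F w) XI →
    (∀ u v → u ∈ C₁ → v ∈ C₁ → Reff F XI u v ≤ R) →
    (∀ u v → u ∈ C₂ → v ∈ C₂ → Reff F XI u v ≤ R) →
    (∀ u v → u ∈ C₁ → v ∈ C₂ → γ * R ≤ Reff F XI u v) →
    (m : ℕ) (π : Fin n → Fin m) (s t : Fin m) → IsIdentification C₁ C₂ π s t →
    (XJ : Matrix F m) → IsPseudoinverse F (Laplacian F (Contract F w π)) XJ →
    (γ - 4#) * R ≤ Reff F XJ s t
mainTheorem13 F n w w-graph connected C₁ C₂ R γ _ XI XI-pinv diam₁ diam₂ separated m π s t π-identifies XJ XJ-pinv =
  begin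
    (γ - 4#) * R                           ≈⟨ [y-z]x≈yx-zx R γ 4# ⟩
    γ * R - 4# * R                         ≈⟨ +-congˡ (-‿cong (4#*x≈x+x+x+x R)) ⟩
    γ * R - (R + R + R + R)                ≤⟨ +-monoˡ-≤ _ (separated u v section-s∈C₁ section-t∈C₂) ⟩
    Reff F XI u v - (R + R + R + R)        ≤⟨ Reff-Contract≥Reff-4R w-graph connected XI-pinv diam₁ diam₂ π-identifies XJ-pinv
                                                section-s∈C₁ section-t∈C₂ ⟩
    Reff F XJ s t                          ∎
  where
  open OrderedField F
  open OrderedFieldProperties F
  open import Algebra.Properties.Ring ring using ([y-z]x≈yx-zx)
  open IdentificationProperties F w w-graph π-identifies
  open ClusterContraction F using (Reff-Contract≥Reff-4R)
  open ≤-Reasoning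
  u v : Fin n
  u = section s
  v = section t
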